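{- For all behaviours B1 and B2: B1 [>>] B2 holds if and only if B1 [V] B2 == B1, i.e. B1 is above B2 in the branching order exactly when merging B1 with B2 is defined and yields B1.
   Context: Behaviours of the process language SP are given by the grammar B ::= End | p!e @! a; B | p?x @? a; B | p(+)l @+ a; B | p & mB1 // mB2 | If e Then B1 Else B2 | Call X, with mB ::= None | Some (a,B) and labels l in {left, right}; in the branching term p & mB1 // mB2, mB1 is the (optional, annotated) behaviour offered for label left and mB2 the one for label right. The merge relation B1 [V] B2 == B (merge B1 B2 B) is defined inductively: End [V] End == End; Call X [V] Call X == Call X; two send terms (resp. receive, selection terms) with identical prefix p!e @!a (resp. p?x @?a, p(+)l @+a) merge to that prefix followed by the merge of their continuations; two conditionals If e Then Bt1 Else Be1 and If e Then Bt2 Else Be2 with the same guard merge to If e Then Bt Else Be where Bt1 [V] Bt2 == Bt and Be1 [V] Be2 == Be; two branching terms on the same process p merge label by label: if both offer a label (with the same annotation) the continuations are merged, if only one offers it that offer is kept, if neither offers it the result offers None. No other pairs are mergeable. The branching order B [>>] B' (more_branches) is defined inductively: End [>>] End; Call X [>>] Call X; congruence for send, receive and selection prefixes (same prefix, continuations related); If e Then B1 Else B2 [>>] If e Then B1' Else B2' when B1 [>>] B1' and B2 [>>] B2'; and for branching terms p & mBl // mBr [>>] p & None // None, p & mBl // Some (a,Br) [>>] p & None // Some (a,Br') if Br [>>] Br', p & Some (a,Bl) // mBr [>>] p & Some (a,Bl') // None if Bl [>>] Bl', and p & Some (a,Bl) // Some (a',Br) [>>] p & Some (a,Bl') // Some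 (a',Br') if Bl [>>] Bl' and Br [>>] Br'. Intuitively, B [>>] B' means B offers at least the branches offered by B'. -}

module Defs where

open import Data.Maybe using (Maybe; just; nothing)
open import Data.Product using (_×_; _,_)

-- The syntax of SP behaviours, parametric in the sets of
--   P : process names,  E : expressions,  V : variables,
--   A : annotations,    X : recursion (procedure) variables.
module SP (P E V A X : Set) where

  data Label : Set where
    left right : Label

  data Behaviour : Set where
    End     : Behaviour
    Send    : P → E → A → Behaviour → Behaviour
    Recv    : P → V → A → Behaviour → Behaviour
    Sel     : P → Label → A → Behaviour → Behaviour
    Branch  : P → Maybe (A × Behaviour) → Maybe (A × Behaviour) → Behaviour
    IfThenElse : E → Behaviour → Behaviour → Behaviour
    Call    : X → Behaviour

  -- merge B1 B2 B   (written B1 [V] B2 == B)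
  data Merge : Behaviour → Behaviour → Behaviour → Set
  data MergeOpt : Maybe (A × Behaviour) → Maybe (A × Behaviour) → Maybe (A × Behaviour) → Set

  data Merge where
    m-end  : Merge End End End
    m-call : ∀ x → Merge (Call x) (Call x) (Call x)
    m-send : ∀ p e a {B1 B2 B} → Merge B1 B2 B → Merge (Send p e a B1) (Send p e a B2) (Send p e a B)
    m-recv : ∀ p x a {B1 B2 B} → Merge B1 B2 B → Merge (Recv p x a B1) (Recv p x a B2) (Recv p x a B)
    m-sel  : ∀ p l a {B1 B2 B} → Merge B1 B2 B → Merge (Sel p l a B1) (Sel p l a B2) (Sel p l a B)
    m-if   : ∀ e {Bt1 Be1 Bt2 Be2 Bt Be} → Merge Bt1 Bt2 Bt → Merge Be1 Be2 Be →
             Merge (IfThenElse e Bt1 Be1) (IfThenElse e Bt2 Be2) (IfThenElse e Bt Be)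
    m-branch : ∀ p {l1 r1 l2 r2 l r} → MergeOpt l1 l2 l → MergeOpt r1 r2 r →
             Merge (Branch p l1 r1) (Branch p l2 r2) (Branch p l r)

  data MergeOpt where
    mo-both  : ∀ a {B1 B2 B} → Merge B1 B2 B → MergeOpt (just (a , B1)) (just (a , B2)) (just (a , B))
    mo-left  : ∀ aB → MergeOpt (just aB) nothing (just aB)
    mo-right : ∀ aB → MergeOpt nothing (just aB) (just aB)
    mo-none  : MergeOpt nothing nothing nothing

  -- branching order B [>>] B'  (more_branches)
  data MoreBranches : Behaviour → Behaviour → Set where
    mb-end  : MoreBranches End End
    mb-call : ∀ x → MoreBranches (Call x) (Call x)
    mb-send : ∀ p e a {B B'} → MoreBranches B B' → MoreBranches (Send p e a B) (Send p e a B')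
    mb-recv : ∀ p x a {B B'} → MoreBranches B B' → MoreBranches (Recv p x a B) (Recv p x a B')
    mb-sel  : ∀ p l a {B B'} → MoreBranches B B' → MoreBranches (Sel p l a B) (Sel p l a B')
    mb-if   : ∀ e {B1 B2 B1' B2'} → MoreBranches B1 B1' → MoreBranches B2 B2' →
              MoreBranches (IfThenElse e B1 B2) (IfThenElse e B1' B2')
    mb-none : ∀ p mBl mBr → MoreBranches (Branch p mBl mBr) (Branch p nothing nothing)
    mb-right : ∀ p mBl a {Br Br'} → MoreBranches Br Br' →
              MoreBranches (Branch p mBl (just (a , Br))) (Branch p nothing (just (a , Br')))
    mb-left : ∀ p a mBr {Bl Bl'} → MoreBranches Bl Bl' →
              MoreBranches (Branch p (just (a , Bl)) mBr) (Branch p (just (a , Bl')) nothing)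
    mb-both : ∀ p a a' {Bl Bl' Br Br'} → MoreBranches Bl Bl' → MoreBranches Br Br' →
              MoreBranches (Branch p (just (a , Bl)) (just (a' , Br)))
                           (Branch p (just (a , Bl')) (just (a' , Br')))

module Submission where

open import Defs
open import Data.Product using (_×_; _,_)
open import Data.Maybe using (Maybe; just; nothing)

module _ {P E V A X : Set} where
  open SP P E V A X

  MergeOpt-identityʳ : (mB : Maybe (A × Behaviour)) → MergeOpt mB nothing mB
  MergeOpt-identityʳ nothing   = mo-none
  MergeOpt-identityʳ (just aB) = mo-left aB

  MoreBranches⇒Merge : ∀ {B B'} → MoreBranches B B' → Merge B B' B
  MoreBranches⇒Merge mb-end               = m-end
  MoreBranches⇒Merge (mb-call x)          = m-call x
  MoreBranches⇒Merge (mb-send p e a B≥B') = m-send p e a (MoreBranches⇒Merge B≥B')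
  MoreBranches⇒Merge (mb-recv p x a B≥B') = m-recv p x a (MoreBranches⇒Merge B≥B')
  MoreBranches⇒Merge (mb-sel p l a B≥B')  = m-sel p l a (MoreBranches⇒Merge B≥B')
  MoreBranches⇒Merge (mb-if e t≥t' e≥e')  =
    m-if e (MoreBranches⇒Merge t≥t') (MoreBranches⇒Merge e≥e')
  MoreBranches⇒Merge (mb-none p mBl mBr)  =
    m-branch p (MergeOpt-identityʳ mBl) (MergeOpt-identityʳ mBr)
  MoreBranches⇒Merge (mb-right p mBl a r≥r') =
    m-branch p (MergeOpt-identityʳ mBl) (mo-both a (MoreBranches⇒Merge r≥r'))
  MoreBranches⇒Merge (mb-left p a mBr l≥l') =
    m-branch p (mo-both a (MoreBranches⇒Merge l≥l')) (MergeOpt-identityʳ mBr)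
  MoreBranches⇒Merge (mb-both p a a' l≥l' r≥r') =
    m-branch p (mo-both a (MoreBranches⇒Merge l≥l')) (mo-both a' (MoreBranches⇒Merge r≥r'))

  -- No mo-right case: it would put into the merge a branch that B does not offer.
  Merge⇒MoreBranches : ∀ {B B'} → Merge B B' B → MoreBranches B B'
  Merge⇒MoreBranches m-end               = mb-end
  Merge⇒MoreBranches (m-call x)          = mb-call x
  Merge⇒MoreBranches (m-send p e a B⊔B') = mb-send p e a (Merge⇒MoreBranches B⊔B')
  Merge⇒MoreBranches (m-recv p x a B⊔B') = mb-recv p x a (Merge⇒MoreBranches B⊔B')
  Merge⇒MoreBranches (m-sel p l a B⊔B')  = mb-sel p l a (Merge⇒MoreBranches B⊔B')
  Merge⇒MoreBranches (m-if e t⊔t' e⊔e')  =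
    mb-if e (Merge⇒MoreBranches t⊔t') (Merge⇒MoreBranches e⊔e')
  Merge⇒MoreBranches (m-branch p (mo-both a l⊔l') (mo-both a' r⊔r')) =
    mb-both p a a' (Merge⇒MoreBranches l⊔l') (Merge⇒MoreBranches r⊔r')
  Merge⇒MoreBranches (m-branch p (mo-both a l⊔l') (mo-left aB)) =
    mb-left p a (just aB) (Merge⇒MoreBranches l⊔l')
  Merge⇒MoreBranches (m-branch p (mo-both a l⊔l') mo-none) =
    mb-left p a nothing (Merge⇒MoreBranches l⊔l')
  Merge⇒MoreBranches (m-branch p (mo-left aB) (mo-both a r⊔r')) =
    mb-right p (just aB) a (Merge⇒MoreBranches r⊔r')
  Merge⇒MoreBranches (m-branch p mo-none (mo-both a r⊔r')) =
    mb-right p nothing a (Merge⇒MoreBranches r⊔r')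
  Merge⇒MoreBranches (m-branch p (mo-left aB) (mo-left aB')) = mb-none p (just aB) (just aB')
  Merge⇒MoreBranches (m-branch p (mo-left aB) mo-none)       = mb-none p (just aB) nothing
  Merge⇒MoreBranches (m-branch p mo-none (mo-left aB'))      = mb-none p nothing (just aB')
  Merge⇒MoreBranches (m-branch p mo-none mo-none)            = mb-none p nothing nothing

mainTheorem11 : (P E V A X : Set) → let open SP P E V A X in
    (B1 B2 : Behaviour) → (MoreBranches B1 B2 → Merge B1 B2 B1) × (Merge B1 B2 B1 → MoreBranches B1 B2)
mainTheorem11 P E V A X B1 B2 = MoreBranches⇒Merge , Merge⇒MoreBranches
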